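{- Every graph $H$ is the $\gamma_{ID}$-graph of infinitely many graphs; that is, for every graph $H$ there exist infinitely many graphs $G$ with $G(\gamma_{ID})\cong H$.
   Context: For a graph $G$, a set $S\subseteq V(G)$ is an identifying code if for every $v\in V(G)$ the set $N[v]\cap S$ is nonempty and these sets are pairwise distinct over all vertices $v$. $\gamma_{ID}(G)$ is the minimum cardinality of an identifying code, and a $\gamma_{ID}$-set is an identifying code of that cardinality. The $\gamma_{ID}$-graph $G(\gamma_{ID})$ has one vertex for each $\gamma_{ID}$-set of $G$, and the vertices corresponding to $S_u,S_w$ are adjacent iff there exist $u'\in S_u$, $w'\in S_w$ with $u'w'\in E(G)$ and $S_w=(S_u-\{u'\})\cup\{w'\}$. -}

module Defs where

open import Data.Nat using (ℕ; _≤_)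
open import Data.Bool using (Bool; true; false; _∨_)
open import Data.Fin using (Fin)
open import Data.Fin.Properties using () renaming (_≟_ to _≟ᶠ_)
open import Data.Fin.Subset using (Subset; _∈_; _∩_; _∪_; _-_; ⁅_⁆; ∣_∣; Nonempty)
open import Data.Vec using (tabulate)
open import Data.Product using (Σ; ∃; _×_; _,_)
open import Data.List using (List)
open import Data.List.Relation.Unary.All using (All)
open import Relation.Nullary using (¬_; does)
open import Relation.Binary.PropositionalEquality using (_≡_; _≢_)

record Graph : Set where
  field
    n      : ℕ
    adj    : Fin n → Fin n → Bool
    sym    : ∀ u v → adj u v ≡ adj v u
    irrefl : ∀ v → adj v v ≡ false
open Graph public

record _≅_ (G H : Graph) : Set where
  field
    to      : Fin (n G) → Fin (n H)
    from    : Fin (n H) → Fin (n G)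
    from∘to : ∀ x → from (to x) ≡ x
    to∘from : ∀ y → to (from y) ≡ y
    pres    : ∀ u v → adj H (to u) (to v) ≡ adj G u v

N[_]_ : (G : Graph) → Fin (n G) → Subset (n G)
N[ G ] v = tabulate (λ u → does (u ≟ᶠ v) ∨ adj G v u)

IsIDCode : (G : Graph) → Subset (n G) → Set
IsIDCode G S =
  (∀ v → Nonempty ((N[ G ] v) ∩ S)) ×
  (∀ u v → u ≢ v → (N[ G ] u) ∩ S ≢ (N[ G ] v) ∩ S)

IsγIDSet : (G : Graph) → Subset (n G) → Set
IsγIDSet G S = IsIDCode G S × (∀ T → IsIDCode G T → ∣ S ∣ ≤ ∣ T ∣)

γIDAdj : (G : Graph) → Subset (n G) → Subset (n G) → Set
γIDAdj G Su Sw = Σ (Fin (n G)) λ u' → Σ (Fin (n G)) λ w' →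
  u' ∈ Su × w' ∈ Sw × adj G u' w' ≡ true × Sw ≡ (Su - u') ∪ ⁅ w' ⁆

γIDGraphIso : (G H : Graph) → Set
γIDGraphIso G H = Σ (Fin (n H) → Subset (n G)) λ f →
  (∀ i → IsγIDSet G (f i)) ×
  (∀ i j → f i ≡ f j → i ≡ j) ×
  (∀ S → IsγIDSet G S → ∃ λ i → f i ≡ S) ×
  (∀ i j → (adj H i j ≡ true → γIDAdj G (f i) (f j)) ×
           (γIDAdj G (f i) (f j) → adj H i j ≡ true))

module Submission where

-- Given H on k vertices and any m, we build a graph Γ(H, m)
-- containing a copy x i of each vertex of H (with the edges of H), two
-- vertices u, w such that N[u] and N[w] differ exactly in the x's, k + 2
-- small gadgets and m isolated padding vertices.  The gadgets force a fixed
-- set C (their leaves and tips, and the padding) into every identifying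
-- code, separate everything else, and u, w force at least one x j.  Hence
-- the γ_ID-sets are exactly the sets S j = C ∪ {x j}, and S i, S j are
-- adjacent in the γ_ID-graph exactly when x i x j is an edge, i.e. when ij
-- is an edge of H.  Padding makes Γ(H, m) larger than any given graphs.

open import Defs hiding (sym)
open import Data.List using (List; []; _∷_)
open import Data.List.Relation.Unary.All using (All; []; _∷_)
import Data.List.Relation.Unary.All as All
open import Data.Nat using (ℕ; suc; _+_; _*_; _≤_; _<_; z<s)
import Data.Nat.Properties as ℕ
open import Data.Bool using (Bool; true; false; _∧_; _∨_)
open import Data.Bool.Properties using (∧-zeroʳ; ¬-not; ∨-comm; ∨-identityʳ)
import Data.Bool as Bool
open import Data.Fin using (Fin; zero; suc)
open import Data.Fin.Properties using (_≟_; injective⇒≤; any?; +↔⊎; *↔×)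
open import Data.Fin.Subset
  using (Subset; inside; outside; Nonempty; _∈_; _∉_; _⊆_; _─_; _-_; _∪_; _∩_; ⁅_⁆; ∣_∣)
open import Data.Fin.Subset.Properties
  using ( _∈?_; ⊆-antisym; p⊂q⇒∣p∣<∣q∣; p⊆q⇒∣p∣≤∣q∣; x∈⁅x⁆; x∈⁅y⁆⇒x≡y
        ; x∈p∪q⁻; x∈p∪q⁺; x∈p∧x≢y⇒x∈p-y; p─q⊆p; ∪-identityʳ )
open import Data.Vec using (_∷_; lookup; tabulate; here; there)
open import Data.Vec.Properties
  using ( lookup-replicate; lookup-zipWith; lookup∘tabulate; tabulate∘lookup; tabulate-cong
        ; lookup⇒[]=; []=⇒lookup )
open import Data.Product using (Σ; ∃; _×_; _,_; proj₁; proj₂)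
open import Data.Sum using (_⊎_; inj₁; inj₂)
import Data.Sum as Sum
open import Relation.Nullary using (¬_; Dec; does; yes; no; contradiction)
open import Relation.Nullary.Decidable using (map′; does-⇔; dec-true; dec-false)
open import Relation.Binary.Definitions using (DecidableEquality)
open import Function.Bundles using (mk⇔; _↔_; Inverse; mk↔ₛ′)
open import Function.Properties.Inverse using (↔-sym; ↔-trans)
open import Data.Sum.Function.Propositional using (_⊎-↔_)
open import Relation.Binary.PropositionalEquality
  using (_≡_; _≢_; refl; sym; trans; cong; cong₂; subst; subst₂)

∧-true : ∀ x {y} → x ∧ y ≡ true → x ≡ true × y ≡ true
∧-true true y≡true = refl , y≡true

∈─⇒∉ : ∀ {n} {x : Fin n} {p q : Subset n} → x ∈ p ─ q → x ∉ q
∈─⇒∉ {p = _ ∷ p} {outside ∷ q} here ()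
∈─⇒∉ {p = _ ∷ p} {_ ∷ q} (there x∈) (there x∈q) = ∈─⇒∉ x∈ x∈q

∈-⇒≢ : ∀ {n} {x y : Fin n} {p : Subset n} → x ∈ p - y → x ≢ y
∈-⇒≢ {y = y} x∈ refl = ∈─⇒∉ x∈ (x∈⁅x⁆ y)

∣p∪⁅x⁆∣ : ∀ {n} (p : Subset n) (x : Fin n) → x ∉ p → ∣ p ∪ ⁅ x ⁆ ∣ ≡ suc ∣ p ∣
∣p∪⁅x⁆∣ (outside ∷ p) zero x∉p = cong (λ q → suc ∣ q ∣) (∪-identityʳ p)
∣p∪⁅x⁆∣ (inside ∷ p) zero x∉p = contradiction here x∉p
∣p∪⁅x⁆∣ (outside ∷ p) (suc x) x∉p = ∣p∪⁅x⁆∣ p x (λ x∈p → x∉p (there x∈p))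
∣p∪⁅x⁆∣ (inside ∷ p) (suc x) x∉p = cong suc (∣p∪⁅x⁆∣ p x (λ x∈p → x∉p (there x∈p)))

⊆-∣∣-≡ : ∀ {n} {p q : Subset n} → p ⊆ q → ∣ q ∣ ≤ ∣ p ∣ → p ≡ q
⊆-∣∣-≡ {p = p} {q} p⊆q ∣q∣≤∣p∣ = ⊆-antisym p⊆q q⊆p
  where
  q⊆p : q ⊆ p
  q⊆p {x} x∈q with x ∈? p
  ... | yes x∈p = x∈p
  ... | no x∉p = contradiction ∣q∣≤∣p∣ (ℕ.<⇒≱ (p⊂q⇒∣p∣<∣q∣ (p⊆q , x , x∈q , x∉p)))

lookup-⁅⁆ : ∀ {n} (x y : Fin n) → lookup ⁅ x ⁆ y ≡ does (y ≟ x)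
lookup-⁅⁆ zero zero = refl
lookup-⁅⁆ zero (suc y) = lookup-replicate y false
lookup-⁅⁆ (suc x) zero = refl
lookup-⁅⁆ (suc x) (suc y) = lookup-⁅⁆ x y

_==_ : ∀ {N} → Fin N → Fin N → Bool
i == j = does (i ≟ j)

==-refl : ∀ {N} (i : Fin N) → i == i ≡ true
==-refl i = dec-true (i ≟ i) refl

==-sym : ∀ {N} (i j : Fin N) → i == j ≡ j == i
==-sym i j = does-⇔ (mk⇔ sym sym) (i ≟ j) (j ≟ i)

==⇒≡ : ∀ {N} {i j : Fin N} → i == j ≡ true → i ≡ j
==⇒≡ {i = i} {j} e with i ≟ j
... | yes i≡j = i≡j
... | no _ = contradiction e λ ()

subset-ext : ∀ {n} {p q : Subset n} → (∀ z → lookup p z ≡ lookup q z) → p ≡ q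
subset-ext {p = p} {q} p≗q =
  trans (sym (tabulate∘lookup p)) (trans (tabulate-cong p≗q) (tabulate∘lookup q))

≅⇒≤ : ∀ {G G′} → G ≅ G′ → n G ≤ n G′
≅⇒≤ φ = injective⇒≤ λ {x} {y} e → trans (sym (from∘to x)) (trans (cong from e) (from∘to y))
  where open _≅_ φ

module Recognition
  (G H : Graph) (C : Subset (n G)) (x : Fin (n H) → Fin (n G))
  (x-injective : ∀ {i j} → x i ≡ x j → i ≡ j)
  (x∉C : ∀ j → x j ∉ C)
  (x-adj : ∀ i j → adj G (x i) (x j) ≡ adj H i j)
  (S-code : ∀ j → IsIDCode G (C ∪ ⁅ x j ⁆))
  (S-least : ∀ T → IsIDCode G T → ∃ λ j → C ∪ ⁅ x j ⁆ ⊆ T)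
  where

  S : Fin (n H) → Subset (n G)
  S j = C ∪ ⁅ x j ⁆

  x∈S : ∀ j → x j ∈ S j
  x∈S j = x∈p∪q⁺ (inj₂ (x∈⁅x⁆ (x j)))

  x∈S⇒≡ : ∀ {i j} → x i ∈ S j → i ≡ j
  x∈S⇒≡ {i} {j} xi∈ with x∈p∪q⁻ C ⁅ x j ⁆ xi∈
  ... | inj₁ xi∈C = contradiction xi∈C (x∉C i)
  ... | inj₂ xi∈⁅xj⁆ = x-injective (x∈⁅y⁆⇒x≡y (x j) xi∈⁅xj⁆)

  ∈S⇒∈C : ∀ {j z} → z ∈ S j → z ≢ x j → z ∈ C
  ∈S⇒∈C {j} z∈ z≢xj with x∈p∪q⁻ C ⁅ x j ⁆ z∈
  ... | inj₁ z∈C = z∈C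
  ... | inj₂ z∈⁅xj⁆ = contradiction (x∈⁅y⁆⇒x≡y (x j) z∈⁅xj⁆) z≢xj

  ∣S∣ : ∀ j → ∣ S j ∣ ≡ suc ∣ C ∣
  ∣S∣ j = ∣p∪⁅x⁆∣ C (x j) (x∉C j)

  -- Each S i is a minimum code: any code contains some S j, which is as large.
  S-γset : ∀ i → IsγIDSet G (S i)
  S-γset i = S-code i , λ T T-code →
    let (j , Sj⊆T) = S-least T T-code
    in subst (_≤ ∣ T ∣) (trans (∣S∣ j) (sym (∣S∣ i))) (p⊆q⇒∣p∣≤∣q∣ Sj⊆T)

  S-injective : ∀ i j → S i ≡ S j → i ≡ j
  S-injective i j eq = x∈S⇒≡ (subst (x i ∈_) eq (x∈S i))

  -- A γ_ID-set contains some S j and is no larger, so it is S j.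
  S-surjective : ∀ T → IsγIDSet G T → ∃ λ j → S j ≡ T
  S-surjective T (T-code , T-min) =
    let (j , Sj⊆T) = S-least T T-code
    in j , ⊆-∣∣-≡ Sj⊆T (T-min (S j) (S-code j))

  S-exchange : ∀ i j → S j ≡ (S i - x i) ∪ ⁅ x j ⁆
  S-exchange i j = ⊆-antisym forth back
    where
    forth : S j ⊆ (S i - x i) ∪ ⁅ x j ⁆
    forth {z} z∈ with z ≟ x j
    ... | yes refl = x∈p∪q⁺ (inj₂ (x∈⁅x⁆ (x j)))
    ... | no z≢xj =
      let z∈C = ∈S⇒∈C z∈ z≢xj
      in x∈p∪q⁺ (inj₁ (x∈p∧x≢y⇒x∈p-y (x∈p∪q⁺ (inj₁ z∈C)) λ { refl → x∉C i z∈C }))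
    back : (S i - x i) ∪ ⁅ x j ⁆ ⊆ S j
    back z∈ with x∈p∪q⁻ (S i - x i) ⁅ x j ⁆ z∈
    ... | inj₁ z∈Si-xi = x∈p∪q⁺ (inj₁ (∈S⇒∈C (p─q⊆p _ _ z∈Si-xi) (∈-⇒≢ z∈Si-xi)))
    ... | inj₂ z∈⁅xj⁆ = subst (_∈ S j) (sym (x∈⁅y⁆⇒x≡y (x j) z∈⁅xj⁆)) (x∈S j)

  adj⇒γIDAdj : ∀ i j → adj H i j ≡ true → γIDAdj G (S i) (S j)
  adj⇒γIDAdj i j ij =
    x i , x j , x∈S i , x∈S j , trans (x-adj i j) ij , S-exchange i j

  -- Conversely an exchange S i → S j must remove x i and insert x j,
  -- and these two vertices are adjacent.
  γIDAdj⇒adj : ∀ i j → γIDAdj G (S i) (S j) → adj H i j ≡ true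
  γIDAdj⇒adj i j (u , w , u∈Si , w∈Sj , uw , Sj≡) with i ≟ j
  ... | yes refl with x∈p∪q⁻ (S i - u) ⁅ w ⁆ (subst (u ∈_) Sj≡ u∈Si)
  ...   | inj₁ u∈Si-u = contradiction refl (∈-⇒≢ u∈Si-u)
  ...   | inj₂ u∈⁅w⁆ with x∈⁅y⁆⇒x≡y w u∈⁅w⁆
  ...     | refl = contradiction (trans (sym uw) (irrefl G u)) λ ()
  γIDAdj⇒adj i j (u , w , u∈Si , w∈Sj , uw , Sj≡) | no i≢j =
    trans (sym (x-adj i j)) (subst₂ (λ a b → adj G a b ≡ true) (sym removed) (sym inserted) uw)
    where
    removed : x i ≡ u
    removed with x i ≟ u
    ... | yes xi≡u = xi≡u
    ... | no xi≢u = contradiction (x∈S⇒≡ (subst (x i ∈_) (sym Sj≡)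
                      (x∈p∪q⁺ (inj₁ (x∈p∧x≢y⇒x∈p-y (x∈S i) xi≢u))))) i≢j
    inserted : x j ≡ w
    inserted with x∈p∪q⁻ (S i - u) ⁅ w ⁆ (subst (x j ∈_) Sj≡ (x∈S j))
    ... | inj₁ xj∈Si-u = contradiction (sym (x∈S⇒≡ (p─q⊆p _ _ xj∈Si-u))) i≢j
    ... | inj₂ xj∈⁅w⁆ = x∈⁅y⁆⇒x≡y w xj∈⁅w⁆

  γIDGraph≅H : γIDGraphIso G H
  γIDGraph≅H = S , S-γset , S-injective , S-surjective ,
    λ i j → adj⇒γIDAdj i j , γIDAdj⇒adj i j

-- Identifying codes of a graph given by a closed-neighbourhood indicator
-- nbhd on an arbitrary vertex type V; codes are boolean predicates on V.
module Codes {V : Set} (nbhd : V → V → Bool) where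

  trace : (V → Bool) → V → V → Bool
  trace P a y = nbhd a y ∧ P y

  SameTrace : (V → Bool) → V → V → Set
  SameTrace P a b = ∀ y → trace P a y ≡ trace P b y

  IsIDCodeᵥ : (V → Bool) → Set
  IsIDCodeᵥ P = (∀ a → ∃ λ y → trace P a y ≡ true) × (∀ a b → a ≢ b → ¬ SameTrace P a b)

  record Separated (P : V → Bool) (a b : V) : Set where
    constructor separatedBy
    field
      witness : V
      differs : trace P a witness ≢ trace P b witness

  Separated⇒¬SameTrace : ∀ {P a b} → Separated P a b → ¬ SameTrace P a b
  Separated⇒¬SameTrace (separatedBy y differs) same = differs (same y)

  module _ {P : V → Bool} {a b : V} where

    only-first : ∀ y → trace P a y ≡ true → trace P b y ≡ false → Separated P a b
    only-first y a∋y b∌y = separatedBy y λ e → contradiction (trans (sym a∋y) (trans e b∌y)) λ ()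

    only-second : ∀ y → trace P a y ≡ false → trace P b y ≡ true → Separated P a b
    only-second y a∌y b∋y = separatedBy y λ e → contradiction (trans (sym a∌y) (trans e b∋y)) λ ()

    separate-at : ∀ y → trace P a y ≡ true → (nbhd b y ≡ true → Separated P a b) → Separated P a b
    separate-at y a∋y b-dominates with nbhd b y in b∼y
    ... | true = b-dominates refl
    ... | false = only-first y a∋y (cong (_∧ P y) b∼y)

  forced-among : ∀ {P k} → IsIDCodeᵥ P → (f : Fin k → V) → ∀ a b → a ≢ b →
    (∀ y → nbhd a y ≡ nbhd b y ⊎ ∃ λ i → y ≡ f i) → ∃ λ i → P (f i) ≡ true
  forced-among {P} (_ , separated) f a b a≢b agree with any? (λ i → P (f i) Bool.≟ true)
  ... | yes hit = hit
  ... | no none = contradiction same (separated a b a≢b)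
    where
    same : SameTrace P a b
    same y with agree y
    ... | inj₁ nbhd-eq = cong (_∧ P y) nbhd-eq
    ... | inj₂ (i , refl) =
      let P[fi]≡false = ¬-not (λ e → none (i , e))
      in trans (cong (nbhd a y ∧_) P[fi]≡false) (trans (∧-zeroʳ (nbhd a y))
           (sym (trans (cong (nbhd b y ∧_) P[fi]≡false) (∧-zeroʳ (nbhd b y)))))

  forced : ∀ {P} → IsIDCodeᵥ P → ∀ y₀ a b → a ≢ b →
    (∀ y → nbhd a y ≡ nbhd b y ⊎ y ≡ y₀) → P y₀ ≡ true
  forced P-code y₀ a b a≢b agree =
    proj₂ (forced-among P-code (λ (_ : Fin 1) → y₀) a b a≢b λ y → Sum.map₂ (zero ,_) (agree y))

  forced-isolated : ∀ {P} → IsIDCodeᵥ P → ∀ a → (∀ y → nbhd a y ≡ true → y ≡ a) → P a ≡ true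
  forced-isolated {P} (dominated , _) a isolated =
    let (y , a∋y) = dominated a
        (a∼y , P[y]) = ∧-true (nbhd a y) a∋y
    in subst (λ z → P z ≡ true) (isolated y a∼y) P[y]

module Encoded
  {V : Set} {N : ℕ} (encoding : V ↔ Fin N)
  (adjᵥ : V → V → Bool)
  (adjᵥ-sym : ∀ a b → adjᵥ a b ≡ adjᵥ b a) (adjᵥ-irr : ∀ a → adjᵥ a a ≡ false)
  (nbhd : V → V → Bool)
  (nbhd-self : ∀ a → nbhd a a ≡ true) (nbhd-other : ∀ a y → a ≢ y → nbhd a y ≡ adjᵥ a y)
  where

  open Codes nbhd public

  enc : V → Fin N
  enc = Inverse.to encoding

  dec : Fin N → V
  dec = Inverse.from encoding

  dec∘enc : ∀ a → dec (enc a) ≡ a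
  dec∘enc = Inverse.strictlyInverseʳ encoding

  enc∘dec : ∀ z → enc (dec z) ≡ z
  enc∘dec = Inverse.strictlyInverseˡ encoding

  graph : Graph
  graph = record
    { n = N ; adj = λ u v → adjᵥ (dec u) (dec v)
    ; sym = λ u v → adjᵥ-sym (dec u) (dec v) ; irrefl = λ u → adjᵥ-irr (dec u) }

  enc-injective : ∀ {a b} → enc a ≡ enc b → a ≡ b
  enc-injective {a} {b} e = trans (sym (dec∘enc a)) (trans (cong dec e) (dec∘enc b))

  dec-injective : ∀ {u v} → dec u ≡ dec v → u ≡ v
  dec-injective {u} {v} e = trans (sym (enc∘dec u)) (trans (cong enc e) (enc∘dec v))

  _≟ᵥ_ : DecidableEquality V
  a ≟ᵥ b = map′ enc-injective (cong enc) (enc a ≟ enc b)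

  record Represents (T : Subset N) (P : V → Bool) : Set where
    constructor represents
    field
      lookup≡ : ∀ z → lookup T z ≡ P (dec z)
  open Represents public

  represents-self : ∀ T → Represents T (λ a → lookup T (enc a))
  represents-self T = represents λ z → cong (lookup T) (sym (enc∘dec z))

  represents-≗ : ∀ {T P Q} → (∀ a → P a ≡ Q a) → Represents T P → Represents T Q
  represents-≗ P≗Q T~P = represents λ z → trans (lookup≡ T~P z) (P≗Q (dec z))

  represents-tabulate : ∀ P → Represents (tabulate (λ z → P (dec z))) P
  represents-tabulate P = represents (lookup∘tabulate (λ z → P (dec z)))

  represents-⁅⁆ : ∀ b → Represents ⁅ enc b ⁆ (λ a → does (a ≟ᵥ b))
  represents-⁅⁆ b = represents λ z → trans (lookup-⁅⁆ (enc b) z)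
    (does-⇔ (mk⇔ (trans (enc∘dec z)) (trans (sym (enc∘dec z)))) (z ≟ enc b) (enc (dec z) ≟ enc b))

  represents-∪ : ∀ {S T P Q} → Represents S P → Represents T Q →
    Represents (S ∪ T) (λ a → P a ∨ Q a)
  represents-∪ {S} {T} S~P T~Q = represents λ z →
    trans (lookup-zipWith _∨_ z S T) (cong₂ _∨_ (lookup≡ S~P z) (lookup≡ T~Q z))

  represents-⊆ : ∀ {S T P Q} → Represents S P → Represents T Q →
    (∀ a → P a ≡ true → Q a ≡ true) → S ⊆ T
  represents-⊆ {S} {T} S~P T~Q P⇒Q {z} z∈S =
    lookup⇒[]= z T (trans (lookup≡ T~Q z)
      (P⇒Q (dec z) (trans (sym (lookup≡ S~P z)) ([]=⇒lookup z∈S))))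

  N-lookup : ∀ u z → lookup (N[ graph ] u) z ≡ nbhd (dec u) (dec z)
  N-lookup u z = trans (lookup∘tabulate _ z) (by-equality (z ≟ u))
    where
    by-equality : (d : Dec (z ≡ u)) → does d ∨ adjᵥ (dec u) (dec z) ≡ nbhd (dec u) (dec z)
    by-equality (yes refl) = sym (nbhd-self (dec z))
    by-equality (no z≢u) = sym (nbhd-other (dec u) (dec z) λ e → z≢u (dec-injective (sym e)))

  module _ {T : Subset N} {P : V → Bool} (T~P : Represents T P) where

    trace-lookup : ∀ u z → lookup (N[ graph ] u ∩ T) z ≡ nbhd (dec u) (dec z) ∧ P (dec z)
    trace-lookup u z =
      trans (lookup-zipWith _∧_ z (N[ graph ] u) T) (cong₂ _∧_ (N-lookup u z) (lookup≡ T~P z))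

    trace-enc : ∀ u y → lookup (N[ graph ] u ∩ T) (enc y) ≡ nbhd (dec u) y ∧ P y
    trace-enc u y =
      trans (trace-lookup u (enc y)) (cong (λ y′ → nbhd (dec u) y′ ∧ P y′) (dec∘enc y))

    trace-of-enc : ∀ a z → lookup (N[ graph ] (enc a) ∩ T) z ≡ nbhd a (dec z) ∧ P (dec z)
    trace-of-enc a z =
      trans (trace-lookup (enc a) z) (cong (λ a′ → nbhd a′ (dec z) ∧ P (dec z)) (dec∘enc a))

    toIsIDCode : IsIDCodeᵥ P → IsIDCode graph T
    toIsIDCode (dominated , separated) = dominated′ , separated′
      where
      dominated′ : ∀ u → Nonempty (N[ graph ] u ∩ T)
      dominated′ u =
        let (y , y∈) = dominated (dec u)
        in enc y , lookup⇒[]= (enc y) _ (trans (trace-enc u y) y∈)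
      separated′ : ∀ u v → u ≢ v → N[ graph ] u ∩ T ≢ N[ graph ] v ∩ T
      separated′ u v u≢v eq = separated (dec u) (dec v) (λ e → u≢v (dec-injective e)) λ y →
        trans (sym (trace-enc u y)) (trans (cong (λ s → lookup s (enc y)) eq) (trace-enc v y))

    fromIsIDCode : IsIDCode graph T → IsIDCodeᵥ P
    fromIsIDCode (dominated , separated) = dominated′ , separated′
      where
      dominated′ : ∀ a → ∃ λ y → nbhd a y ∧ P y ≡ true
      dominated′ a =
        let (z , z∈) = dominated (enc a)
        in dec z , trans (sym (trace-of-enc a z)) ([]=⇒lookup z∈)
      separated′ : ∀ a b → a ≢ b → ¬ SameTrace P a b
      separated′ a b a≢b same = separated (enc a) (enc b) (λ e → a≢b (enc-injective e))
        (subset-ext λ z → trans (trace-of-enc a z) (trans (same (dec z)) (sym (trace-of-enc b z))))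


module Construction (H : Graph) (m : ℕ) where

  k : ℕ
  k = n H

  Site : Set
  Site = Fin (2 + k)

  pattern hub = zero
  pattern pair = suc zero
  pattern at i = suc (suc i)

  -- Each gadget is K₄ minus the edge leaf₁leaf₂ on centre, side, leaf₁, leaf₂,
  -- with a pendant tip at the centre; only the tip meets the rest of the graph.
  Role : Set
  Role = Fin 5

  pattern centre = zero
  pattern side = suc zero
  pattern leaf₁ = suc (suc zero)
  pattern leaf₂ = suc (suc (suc zero))
  pattern tip = suc (suc (suc (suc zero)))

  data Vertex : Set where
    gadget : Site → Role → Vertex
    xv : Fin k → Vertex
    uv wv : Vertex
    pad : Fin m → Vertex

  order : ℕ
  order = (2 + k) * 5 + (k + (2 + m))

  encoding : Vertex ↔ Fin order
  encoding = ↔-trans layout (↔-sym (↔-trans +↔⊎ (*↔× ⊎-↔ +↔⊎)))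
    where
    Layout : Set
    Layout = (Site × Role) ⊎ (Fin k ⊎ Fin (2 + m))
    to : Vertex → Layout
    to (gadget s r) = inj₁ (s , r)
    to (xv i) = inj₂ (inj₁ i)
    to uv = inj₂ (inj₂ zero)
    to wv = inj₂ (inj₂ (suc zero))
    to (pad r) = inj₂ (inj₂ (suc (suc r)))
    from : Layout → Vertex
    from (inj₁ (s , r)) = gadget s r
    from (inj₂ (inj₁ i)) = xv i
    from (inj₂ (inj₂ zero)) = uv
    from (inj₂ (inj₂ (suc zero))) = wv
    from (inj₂ (inj₂ (suc (suc r)))) = pad r
    to∘from : ∀ ℓ → to (from ℓ) ≡ ℓ
    to∘from (inj₁ (s , r)) = refl
    to∘from (inj₂ (inj₁ i)) = refl
    to∘from (inj₂ (inj₂ zero)) = refl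
    to∘from (inj₂ (inj₂ (suc zero))) = refl
    to∘from (inj₂ (inj₂ (suc (suc r)))) = refl
    from∘to : ∀ a → from (to a) ≡ a
    from∘to (gadget s r) = refl
    from∘to (xv i) = refl
    from∘to uv = refl
    from∘to wv = refl
    from∘to (pad r) = refl
    layout : Vertex ↔ Layout
    layout = mk↔ₛ′ to from to∘from from∘to

  link : Role → Role → Bool
  link centre side = true
  link centre leaf₁ = true
  link centre leaf₂ = true
  link centre tip = true
  link side leaf₁ = true
  link side leaf₂ = true
  link _ _ = false

  roleEdge : Role → Role → Bool
  roleEdge r q = link r q ∨ link q r

  roleEdge-irr : ∀ r → roleEdge r r ≡ false
  roleEdge-irr centre = refl
  roleEdge-irr side = refl
  roleEdge-irr leaf₁ = refl
  roleEdge-irr leaf₂ = refl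
  roleEdge-irr tip = refl

  isTip : Role → Bool
  isTip tip = true
  isTip _ = false

  tipSeesX : Site → Fin k → Bool
  tipSeesX hub j = true
  tipSeesX pair j = false
  tipSeesX (at i) j = i == j

  tipSeesUW : Site → Bool
  tipSeesUW hub = true
  tipSeesUW pair = true
  tipSeesUW (at i) = false

  adjᵥ : Vertex → Vertex → Bool
  adjᵥ (gadget s r) (gadget t q) = roleEdge r q ∧ (s == t)
  adjᵥ (gadget s r) (xv j) = isTip r ∧ tipSeesX s j
  adjᵥ (gadget s r) uv = isTip r ∧ tipSeesUW s
  adjᵥ (gadget s r) wv = isTip r ∧ tipSeesUW s
  adjᵥ (xv i) (gadget s r) = isTip r ∧ tipSeesX s i
  adjᵥ (xv i) (xv j) = adj H i j
  adjᵥ (xv i) wv = true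
  adjᵥ uv (gadget s r) = isTip r ∧ tipSeesUW s
  adjᵥ uv wv = true
  adjᵥ wv (gadget s r) = isTip r ∧ tipSeesUW s
  adjᵥ wv (xv j) = true
  adjᵥ wv uv = true
  adjᵥ _ _ = false

  -- Closed neighbourhoods, written so that they compute on constructors.
  nbhd : Vertex → Vertex → Bool
  nbhd (gadget s r) (gadget t q) = (r == q ∨ roleEdge r q) ∧ (s == t)
  nbhd (xv i) (xv j) = i == j ∨ adj H i j
  nbhd uv uv = true
  nbhd wv wv = true
  nbhd (pad r) (pad r′) = r == r′
  nbhd a y = adjᵥ a y

  adjᵥ-sym : ∀ a b → adjᵥ a b ≡ adjᵥ b a
  adjᵥ-sym (gadget s r) (gadget t q) = cong₂ _∧_ (∨-comm (link r q) (link q r)) (==-sym s t)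
  adjᵥ-sym (gadget s r) (xv j) = refl
  adjᵥ-sym (gadget s r) uv = refl
  adjᵥ-sym (gadget s r) wv = refl
  adjᵥ-sym (gadget s r) (pad r′) = refl
  adjᵥ-sym (xv i) (gadget t q) = refl
  adjᵥ-sym (xv i) (xv j) = Graph.sym H i j
  adjᵥ-sym (xv i) uv = refl
  adjᵥ-sym (xv i) wv = refl
  adjᵥ-sym (xv i) (pad r′) = refl
  adjᵥ-sym uv (gadget t q) = refl
  adjᵥ-sym uv (xv j) = refl
  adjᵥ-sym uv uv = refl
  adjᵥ-sym uv wv = refl
  adjᵥ-sym uv (pad r′) = refl
  adjᵥ-sym wv (gadget t q) = refl
  adjᵥ-sym wv (xv j) = refl
  adjᵥ-sym wv uv = refl
  adjᵥ-sym wv wv = refl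
  adjᵥ-sym wv (pad r′) = refl
  adjᵥ-sym (pad r) (gadget t q) = refl
  adjᵥ-sym (pad r) (xv j) = refl
  adjᵥ-sym (pad r) uv = refl
  adjᵥ-sym (pad r) wv = refl
  adjᵥ-sym (pad r) (pad r′) = refl

  adjᵥ-irr : ∀ a → adjᵥ a a ≡ false
  adjᵥ-irr (gadget s r) = cong (_∧ (s == s)) (roleEdge-irr r)
  adjᵥ-irr (xv i) = irrefl H i
  adjᵥ-irr uv = refl
  adjᵥ-irr wv = refl
  adjᵥ-irr (pad r) = refl

  nbhd-self : ∀ a → nbhd a a ≡ true
  nbhd-self (gadget s r) rewrite ==-refl r | ==-refl s = refl
  nbhd-self (xv i) rewrite ==-refl i = refl
  nbhd-self uv = refl
  nbhd-self wv = refl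
  nbhd-self (pad r) = ==-refl r

  nbhd-other : ∀ a y → a ≢ y → nbhd a y ≡ adjᵥ a y
  nbhd-other (gadget s r) (gadget t q) a≢y with r ≟ q
  ... | no _ = refl
  ... | yes refl rewrite dec-false (s ≟ t) (λ { refl → a≢y refl }) | ∧-zeroʳ (roleEdge r r) = refl
  nbhd-other (xv i) (xv j) a≢y rewrite dec-false (i ≟ j) (λ { refl → a≢y refl }) = refl
  nbhd-other uv uv a≢y = contradiction refl a≢y
  nbhd-other wv wv a≢y = contradiction refl a≢y
  nbhd-other (pad r) (pad r′) a≢y = dec-false (r ≟ r′) (λ { refl → a≢y refl })
  nbhd-other (gadget s r) (xv j) _ = refl
  nbhd-other (gadget s r) uv _ = refl
  nbhd-other (gadget s r) wv _ = refl
  nbhd-other (gadget s r) (pad r′) _ = refl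
  nbhd-other (xv i) (gadget t q) _ = refl
  nbhd-other (xv i) uv _ = refl
  nbhd-other (xv i) wv _ = refl
  nbhd-other (xv i) (pad r′) _ = refl
  nbhd-other uv (gadget t q) _ = refl
  nbhd-other uv (xv j) _ = refl
  nbhd-other uv wv _ = refl
  nbhd-other uv (pad r′) _ = refl
  nbhd-other wv (gadget t q) _ = refl
  nbhd-other wv (xv j) _ = refl
  nbhd-other wv uv _ = refl
  nbhd-other wv (pad r′) _ = refl
  nbhd-other (pad r) (gadget t q) _ = refl
  nbhd-other (pad r) (xv j) _ = refl
  nbhd-other (pad r) uv _ = refl
  nbhd-other (pad r) wv _ = refl

  open Encoded encoding adjᵥ adjᵥ-sym adjᵥ-irr nbhd nbhd-self nbhd-other public
  inCore : Vertex → Bool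
  inCore (gadget s leaf₁) = true
  inCore (gadget s leaf₂) = true
  inCore (gadget s tip) = true
  inCore (pad r) = true
  inCore _ = false

  isX : Fin k → Vertex → Bool
  isX j (xv i) = i == j
  isX j _ = false

  codeᵥ : Fin k → Vertex → Bool
  codeᵥ j a = inCore a ∨ isX j a

  -- The shape of "y belongs to the trace" in the verifications below.
  ==-refl∧ : ∀ {N} (i : Fin N) → (i == i) ∧ true ≡ true
  ==-refl∧ i rewrite ==-refl i = refl

  at-site : ∀ {s t} → t == s ≡ true → ∀ r → gadget t r ≡ gadget s r
  at-site e r = cong (λ t → gadget t r) (==⇒≡ e)

  dominators-leaf₁ : ∀ s b → nbhd b (gadget s leaf₁) ≡ true →
    b ≡ gadget s centre ⊎ b ≡ gadget s side ⊎ b ≡ gadget s leaf₁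
  dominators-leaf₁ s (gadget t centre) e = inj₁ (at-site e centre)
  dominators-leaf₁ s (gadget t side) e = inj₂ (inj₁ (at-site e side))
  dominators-leaf₁ s (gadget t leaf₁) e = inj₂ (inj₂ (at-site e leaf₁))
  dominators-leaf₁ s (gadget t leaf₂) ()
  dominators-leaf₁ s (gadget t tip) ()
  dominators-leaf₁ s (xv i) ()
  dominators-leaf₁ s uv ()
  dominators-leaf₁ s wv ()
  dominators-leaf₁ s (pad r) ()

  dominators-leaf₂ : ∀ s b → nbhd b (gadget s leaf₂) ≡ true →
    b ≡ gadget s centre ⊎ b ≡ gadget s side ⊎ b ≡ gadget s leaf₂
  dominators-leaf₂ s (gadget t centre) e = inj₁ (at-site e centre)
  dominators-leaf₂ s (gadget t side) e = inj₂ (inj₁ (at-site e side))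
  dominators-leaf₂ s (gadget t leaf₁) ()
  dominators-leaf₂ s (gadget t leaf₂) e = inj₂ (inj₂ (at-site e leaf₂))
  dominators-leaf₂ s (gadget t tip) ()
  dominators-leaf₂ s (xv i) ()
  dominators-leaf₂ s uv ()
  dominators-leaf₂ s wv ()
  dominators-leaf₂ s (pad r) ()

  dominators-tip-at : ∀ i b → nbhd b (gadget (at i) tip) ≡ true →
    b ≡ gadget (at i) centre ⊎ b ≡ gadget (at i) tip ⊎ b ≡ xv i
  dominators-tip-at i (gadget t centre) e = inj₁ (at-site e centre)
  dominators-tip-at i (gadget t side) ()
  dominators-tip-at i (gadget t leaf₁) ()
  dominators-tip-at i (gadget t leaf₂) ()
  dominators-tip-at i (gadget t tip) e = inj₂ (inj₁ (at-site e tip))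
  dominators-tip-at i (xv i′) e = inj₂ (inj₂ (cong xv (sym (==⇒≡ e))))
  dominators-tip-at i uv ()
  dominators-tip-at i wv ()
  dominators-tip-at i (pad r) ()

  dominators-tip-pair : ∀ b → nbhd b (gadget pair tip) ≡ true →
    b ≡ gadget pair centre ⊎ b ≡ gadget pair tip ⊎ b ≡ uv ⊎ b ≡ wv
  dominators-tip-pair (gadget t centre) e = inj₁ (at-site e centre)
  dominators-tip-pair (gadget t side) ()
  dominators-tip-pair (gadget t leaf₁) ()
  dominators-tip-pair (gadget t leaf₂) ()
  dominators-tip-pair (gadget t tip) e = inj₂ (inj₁ (at-site e tip))
  dominators-tip-pair (xv i) ()
  dominators-tip-pair uv e = inj₂ (inj₂ (inj₁ refl))
  dominators-tip-pair wv e = inj₂ (inj₂ (inj₂ refl))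
  dominators-tip-pair (pad r) ()

  dominators-tip-hub : ∀ b → nbhd b (gadget hub tip) ≡ true →
    b ≡ gadget hub centre ⊎ b ≡ gadget hub tip ⊎ b ≡ uv ⊎ b ≡ wv ⊎ ∃ λ i → b ≡ xv i
  dominators-tip-hub (gadget t centre) e = inj₁ (at-site e centre)
  dominators-tip-hub (gadget t side) ()
  dominators-tip-hub (gadget t leaf₁) ()
  dominators-tip-hub (gadget t leaf₂) ()
  dominators-tip-hub (gadget t tip) e = inj₂ (inj₁ (at-site e tip))
  dominators-tip-hub (xv i) e = inj₂ (inj₂ (inj₂ (inj₂ (i , refl))))
  dominators-tip-hub uv e = inj₂ (inj₂ (inj₁ refl))
  dominators-tip-hub wv e = inj₂ (inj₂ (inj₂ (inj₁ refl)))
  dominators-tip-hub (pad r) ()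

  dominators-pad : ∀ r b → nbhd b (pad r) ≡ true → b ≡ pad r
  dominators-pad r (gadget t q) ()
  dominators-pad r (xv i) ()
  dominators-pad r uv ()
  dominators-pad r wv ()
  dominators-pad r (pad r′) e = cong pad (==⇒≡ e)

  -- Every S_j is an identifying code: each vertex a has a probe in its trace,
  -- and every other vertex dominating that probe is separated from a by a
  -- second vertex of S_j.
  module Separation (j : Fin k) where

    S : Vertex → Bool
    S = codeᵥ j

    probe : ∀ a → ∃ λ y → trace S a y ≡ true
    probe (gadget s centre) = gadget s leaf₁ , ==-refl∧ s
    probe (gadget s side) = gadget s leaf₁ , ==-refl∧ s
    probe (gadget s leaf₁) = gadget s leaf₁ , ==-refl∧ s
    probe (gadget s leaf₂) = gadget s leaf₂ , ==-refl∧ s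
    probe (gadget s tip) = gadget s tip , ==-refl∧ s
    probe (xv i) = gadget (at i) tip , ==-refl∧ i
    probe uv = gadget pair tip , refl
    probe wv = gadget pair tip , refl
    probe (pad r) = pad r , ==-refl∧ r

    centre-vs : ∀ s b → gadget s centre ≢ b →
      b ≡ gadget s centre ⊎ b ≡ gadget s side ⊎ b ≡ gadget s leaf₁ → Separated S (gadget s centre) b
    centre-vs s _ ne (inj₁ refl) = contradiction refl ne
    centre-vs s _ ne (inj₂ (inj₁ refl)) = only-first (gadget s tip) (==-refl∧ s) refl
    centre-vs s _ ne (inj₂ (inj₂ refl)) = only-first (gadget s leaf₂) (==-refl∧ s) refl

    side-vs : ∀ s b → gadget s side ≢ b →
      b ≡ gadget s centre ⊎ b ≡ gadget s side ⊎ b ≡ gadget s leaf₁ → Separated S (gadget s side) b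
    side-vs s _ ne (inj₁ refl) = only-second (gadget s tip) refl (==-refl∧ s)
    side-vs s _ ne (inj₂ (inj₁ refl)) = contradiction refl ne
    side-vs s _ ne (inj₂ (inj₂ refl)) = only-first (gadget s leaf₂) (==-refl∧ s) refl

    leaf₁-vs : ∀ s b → gadget s leaf₁ ≢ b →
      b ≡ gadget s centre ⊎ b ≡ gadget s side ⊎ b ≡ gadget s leaf₁ → Separated S (gadget s leaf₁) b
    leaf₁-vs s _ ne (inj₁ refl) = only-second (gadget s leaf₂) refl (==-refl∧ s)
    leaf₁-vs s _ ne (inj₂ (inj₁ refl)) = only-second (gadget s leaf₂) refl (==-refl∧ s)
    leaf₁-vs s _ ne (inj₂ (inj₂ refl)) = contradiction refl ne

    leaf₂-vs : ∀ s b → gadget s leaf₂ ≢ b →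
      b ≡ gadget s centre ⊎ b ≡ gadget s side ⊎ b ≡ gadget s leaf₂ → Separated S (gadget s leaf₂) b
    leaf₂-vs s _ ne (inj₁ refl) = only-second (gadget s leaf₁) refl (==-refl∧ s)
    leaf₂-vs s _ ne (inj₂ (inj₁ refl)) = only-second (gadget s leaf₁) refl (==-refl∧ s)
    leaf₂-vs s _ ne (inj₂ (inj₂ refl)) = contradiction refl ne

    tip-at-vs : ∀ i b → gadget (at i) tip ≢ b →
      b ≡ gadget (at i) centre ⊎ b ≡ gadget (at i) tip ⊎ b ≡ xv i →
      Separated S (gadget (at i) tip) b
    tip-at-vs i _ ne (inj₁ refl) = only-second (gadget (at i) leaf₁) refl (==-refl∧ i)
    tip-at-vs i _ ne (inj₂ (inj₁ refl)) = contradiction refl ne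
    tip-at-vs i _ ne (inj₂ (inj₂ refl)) = only-second (gadget hub tip) refl refl

    tip-pair-vs : ∀ b → gadget pair tip ≢ b →
      b ≡ gadget pair centre ⊎ b ≡ gadget pair tip ⊎ b ≡ uv ⊎ b ≡ wv →
      Separated S (gadget pair tip) b
    tip-pair-vs _ ne (inj₁ refl) = only-second (gadget pair leaf₁) refl refl
    tip-pair-vs _ ne (inj₂ (inj₁ refl)) = contradiction refl ne
    tip-pair-vs _ ne (inj₂ (inj₂ (inj₁ refl))) = only-second (gadget hub tip) refl refl
    tip-pair-vs _ ne (inj₂ (inj₂ (inj₂ refl))) = only-second (gadget hub tip) refl refl

    tip-hub-vs : ∀ b → gadget hub tip ≢ b →
      b ≡ gadget hub centre ⊎ b ≡ gadget hub tip ⊎ b ≡ uv ⊎ b ≡ wv ⊎ (∃ λ i → b ≡ xv i) →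
      Separated S (gadget hub tip) b
    tip-hub-vs _ ne (inj₁ refl) = only-second (gadget hub leaf₁) refl refl
    tip-hub-vs _ ne (inj₂ (inj₁ refl)) = contradiction refl ne
    tip-hub-vs _ ne (inj₂ (inj₂ (inj₁ refl))) = only-second (gadget pair tip) refl refl
    tip-hub-vs _ ne (inj₂ (inj₂ (inj₂ (inj₁ refl)))) = only-second (gadget pair tip) refl refl
    tip-hub-vs _ ne (inj₂ (inj₂ (inj₂ (inj₂ (i , refl))))) =
      only-second (gadget (at i) tip) refl (==-refl∧ i)

    x-vs : ∀ i b → xv i ≢ b →
      b ≡ gadget (at i) centre ⊎ b ≡ gadget (at i) tip ⊎ b ≡ xv i → Separated S (xv i) b
    x-vs i _ ne (inj₁ refl) = only-second (gadget (at i) leaf₁) refl (==-refl∧ i)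
    x-vs i _ ne (inj₂ (inj₁ refl)) = only-first (gadget hub tip) refl refl
    x-vs i _ ne (inj₂ (inj₂ refl)) = contradiction refl ne

    -- u and w are told apart by x j, the one vertex of S_j outside the core.
    u-vs : ∀ b → uv ≢ b →
      b ≡ gadget pair centre ⊎ b ≡ gadget pair tip ⊎ b ≡ uv ⊎ b ≡ wv → Separated S uv b
    u-vs _ ne (inj₁ refl) = only-second (gadget pair leaf₁) refl refl
    u-vs _ ne (inj₂ (inj₁ refl)) = only-first (gadget hub tip) refl refl
    u-vs _ ne (inj₂ (inj₂ (inj₁ refl))) = contradiction refl ne
    u-vs _ ne (inj₂ (inj₂ (inj₂ refl))) = only-second (xv j) refl (==-refl j)

    w-vs : ∀ b → wv ≢ b →
      b ≡ gadget pair centre ⊎ b ≡ gadget pair tip ⊎ b ≡ uv ⊎ b ≡ wv → Separated S wv b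
    w-vs _ ne (inj₁ refl) = only-second (gadget pair leaf₁) refl refl
    w-vs _ ne (inj₂ (inj₁ refl)) = only-first (gadget hub tip) refl refl
    w-vs _ ne (inj₂ (inj₂ (inj₁ refl))) = only-first (xv j) (==-refl j) refl
    w-vs _ ne (inj₂ (inj₂ (inj₂ refl))) = contradiction refl ne

    against : ∀ a b → a ≢ b → nbhd b (proj₁ (probe a)) ≡ true → Separated S a b
    against (gadget s centre) b ne e = centre-vs s b ne (dominators-leaf₁ s b e)
    against (gadget s side) b ne e = side-vs s b ne (dominators-leaf₁ s b e)
    against (gadget s leaf₁) b ne e = leaf₁-vs s b ne (dominators-leaf₁ s b e)
    against (gadget s leaf₂) b ne e = leaf₂-vs s b ne (dominators-leaf₂ s b e)
    against (gadget (at i) tip) b ne e = tip-at-vs i b ne (dominators-tip-at i b e)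
    against (gadget pair tip) b ne e = tip-pair-vs b ne (dominators-tip-pair b e)
    against (gadget hub tip) b ne e = tip-hub-vs b ne (dominators-tip-hub b e)
    against (xv i) b ne e = x-vs i b ne (dominators-tip-at i b e)
    against uv b ne e = u-vs b ne (dominators-tip-pair b e)
    against wv b ne e = w-vs b ne (dominators-tip-pair b e)
    against (pad r) b ne e = contradiction (sym (dominators-pad r b e)) ne

    separate : ∀ a b → a ≢ b → Separated S a b
    separate a b ne = separate-at (proj₁ (probe a)) (proj₂ (probe a)) (against a b ne)

    isIDCode : IsIDCodeᵥ S
    isIDCode = probe , λ a b ne → Separated⇒¬SameTrace (separate a b ne)

  centre≈side : ∀ s y → nbhd (gadget s centre) y ≡ nbhd (gadget s side) y ⊎ y ≡ gadget s tip
  centre≈side s (gadget t centre) = inj₁ refl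
  centre≈side s (gadget t side) = inj₁ refl
  centre≈side s (gadget t leaf₁) = inj₁ refl
  centre≈side s (gadget t leaf₂) = inj₁ refl
  centre≈side s (gadget t tip) with s ≟ t
  ... | yes refl = inj₂ refl
  ... | no _ = inj₁ refl
  centre≈side s (xv i) = inj₁ refl
  centre≈side s uv = inj₁ refl
  centre≈side s wv = inj₁ refl
  centre≈side s (pad r) = inj₁ refl

  side≈leaf₂ : ∀ s y → nbhd (gadget s side) y ≡ nbhd (gadget s leaf₂) y ⊎ y ≡ gadget s leaf₁
  side≈leaf₂ s (gadget t centre) = inj₁ refl
  side≈leaf₂ s (gadget t side) = inj₁ refl
  side≈leaf₂ s (gadget t leaf₁) with s ≟ t
  ... | yes refl = inj₂ refl
  ... | no _ = inj₁ refl
  side≈leaf₂ s (gadget t leaf₂) = inj₁ refl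
  side≈leaf₂ s (gadget t tip) = inj₁ refl
  side≈leaf₂ s (xv i) = inj₁ refl
  side≈leaf₂ s uv = inj₁ refl
  side≈leaf₂ s wv = inj₁ refl
  side≈leaf₂ s (pad r) = inj₁ refl

  side≈leaf₁ : ∀ s y → nbhd (gadget s side) y ≡ nbhd (gadget s leaf₁) y ⊎ y ≡ gadget s leaf₂
  side≈leaf₁ s (gadget t centre) = inj₁ refl
  side≈leaf₁ s (gadget t side) = inj₁ refl
  side≈leaf₁ s (gadget t leaf₁) = inj₁ refl
  side≈leaf₁ s (gadget t leaf₂) with s ≟ t
  ... | yes refl = inj₂ refl
  ... | no _ = inj₁ refl
  side≈leaf₁ s (gadget t tip) = inj₁ refl
  side≈leaf₁ s (xv i) = inj₁ refl
  side≈leaf₁ s uv = inj₁ refl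
  side≈leaf₁ s wv = inj₁ refl
  side≈leaf₁ s (pad r) = inj₁ refl

  u≈w : ∀ y → nbhd uv y ≡ nbhd wv y ⊎ ∃ λ i → y ≡ xv i
  u≈w (gadget t r) = inj₁ refl
  u≈w (xv i) = inj₂ (i , refl)
  u≈w uv = inj₁ refl
  u≈w wv = inj₁ refl
  u≈w (pad r) = inj₁ refl

  pad-isolated : ∀ r y → nbhd (pad r) y ≡ true → y ≡ pad r
  pad-isolated r (gadget t q) ()
  pad-isolated r (xv i) ()
  pad-isolated r uv ()
  pad-isolated r wv ()
  pad-isolated r (pad r′) e = cong pad (sym (==⇒≡ e))

  module LowerBound {P : Vertex → Bool} (P-code : IsIDCodeᵥ P) where

    core-forced : ∀ a → inCore a ≡ true → P a ≡ true
    core-forced (gadget s leaf₁) _ =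
      forced P-code (gadget s leaf₁) (gadget s side) (gadget s leaf₂) (λ ()) (side≈leaf₂ s)
    core-forced (gadget s leaf₂) _ =
      forced P-code (gadget s leaf₂) (gadget s side) (gadget s leaf₁) (λ ()) (side≈leaf₁ s)
    core-forced (gadget s tip) _ =
      forced P-code (gadget s tip) (gadget s centre) (gadget s side) (λ ()) (centre≈side s)
    core-forced (pad r) _ = forced-isolated P-code (pad r) (pad-isolated r)
    core-forced (gadget s centre) ()
    core-forced (gadget s side) ()
    core-forced (xv i) ()
    core-forced uv ()
    core-forced wv ()

    contains-code : ∃ λ j → ∀ a → codeᵥ j a ≡ true → P a ≡ true
    contains-code = j , covered
      where
      some-x : ∃ λ j → P (xv j) ≡ true
      some-x = forced-among P-code xv uv wv (λ ()) u≈w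
      j : Fin k
      j = proj₁ some-x
      covered : ∀ a → codeᵥ j a ≡ true → P a ≡ true
      covered (gadget s r) e = core-forced (gadget s r) (trans (sym (∨-identityʳ _)) e)
      covered (xv i) e = subst (λ i → P (xv i) ≡ true) (sym (==⇒≡ e)) (proj₂ some-x)
      covered (pad r) e = core-forced (pad r) e

  core : Subset order
  core = tabulate (λ z → inCore (dec z))

  x : Fin k → Fin order
  x j = enc (xv j)

  isX-does : ∀ j a → does (a ≟ᵥ xv j) ≡ isX j a
  isX-does j (gadget s r) = dec-false (gadget s r ≟ᵥ xv j) λ ()
  isX-does j (xv i) = does-⇔ (mk⇔ (λ { refl → refl }) (cong xv)) (xv i ≟ᵥ xv j) (i ≟ j)
  isX-does j uv = dec-false (uv ≟ᵥ xv j) λ ()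
  isX-does j wv = dec-false (wv ≟ᵥ xv j) λ ()
  isX-does j (pad r) = dec-false (pad r ≟ᵥ xv j) λ ()

  code-represents : ∀ j → Represents (core ∪ ⁅ x j ⁆) (codeᵥ j)
  code-represents j = represents-≗ (λ a → cong (inCore a ∨_) (isX-does j a))
    (represents-∪ (represents-tabulate inCore) (represents-⁅⁆ (xv j)))

  x-injective : ∀ {i j} → x i ≡ x j → i ≡ j
  x-injective {i} {j} e with enc-injective {xv i} {xv j} e
  ... | refl = refl

  x∉core : ∀ j → x j ∉ core
  x∉core j xj∈core = contradiction (trans (sym core-at-xj) ([]=⇒lookup xj∈core)) λ ()
    where
    core-at-xj : lookup core (x j) ≡ inCore (xv j)
    core-at-xj = trans (lookup≡ (represents-tabulate inCore) (x j)) (cong inCore (dec∘enc (xv j)))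

  x-adj : ∀ i j → adj graph (x i) (x j) ≡ adj H i j
  x-adj i j = cong₂ adjᵥ (dec∘enc (xv i)) (dec∘enc (xv j))

  code : ∀ j → IsIDCode graph (core ∪ ⁅ x j ⁆)
  code j = toIsIDCode (code-represents j) (Separation.isIDCode j)

  least : ∀ T → IsIDCode graph T → ∃ λ j → core ∪ ⁅ x j ⁆ ⊆ T
  least T T-code =
    let (j , contained) = LowerBound.contains-code (fromIsIDCode (represents-self T) T-code)
    in j , represents-⊆ (code-represents j) (represents-self T) contained

  γIDGraph≅H : γIDGraphIso graph H
  γIDGraph≅H = Recognition.γIDGraph≅H graph H core x x-injective x∉core x-adj code least

  m<order : m < order
  m<order = ℕ.<-≤-trans (ℕ.m<n+m m z<s)
    (ℕ.≤-trans (ℕ.m≤n+m (2 + m) k) (ℕ.m≤n+m _ ((2 + k) * 5)))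

totalOrder : List Graph → ℕ
totalOrder [] = 0
totalOrder (G ∷ Gs) = n G + totalOrder Gs

≤totalOrder : ∀ Gs → All (λ G → n G ≤ totalOrder Gs) Gs
≤totalOrder [] = []
≤totalOrder (G ∷ Gs) =
  ℕ.m≤m+n (n G) (totalOrder Gs) ∷ All.map (λ le → ℕ.≤-trans le (ℕ.m≤n+m _ (n G))) (≤totalOrder Gs)

-- Γ(H, m) for m the total order of L has γ_ID-graph H and is too large
-- to be isomorphic to any graph in L.
corollary6 : (H : Graph) → (L : List Graph) →
    Σ Graph (λ G → All (λ G' → ¬ (G ≅ G')) L × γIDGraphIso G H)
corollary6 H L = graph , All.map larger (≤totalOrder L) , γIDGraph≅H
  where
  open Construction H (totalOrder L)
  larger : ∀ {G′} → n G′ ≤ totalOrder L → ¬ (graph ≅ G′)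
  larger G′≤ φ = ℕ.<⇒≱ m<order (ℕ.≤-trans (≅⇒≤ φ) G′≤)
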